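{- Let $(X,d_X)$ be a metric space, let $\delta>0$ and $0<\varepsilon\le \tfrac18$, and set $\phi=\tfrac34$ and $\gamma=1$. Let $T$ be a rooted tree whose nodes are pairs $(x,i)$ with $x\in X$ and $i$ a nonnegative integer (the level), such that every child of a node $(y,i)$ has level strictly less than $i$. Assume $T$ satisfies the covering property: whenever $(y,i)$ has a child $(x,i')$ with $i'<i$, then $d_X(x,y)\le \phi\,\frac{\delta}{\varepsilon^{i}}$. Then for every node $(x,i)$ of $T$ and every descendant $(y,k)$ of $(x,i)$ with $k<i$, $$d_X(x,y)\le \gamma\frac{\delta}{\varepsilon^{i}}-\gamma\frac{\delta}{\varepsilon^{k}}.$$
   Context: A net tree here is a rooted tree over points of a metric space in which each node is a pair $(x,i)$ consisting of a point $x$ and an integer level $i\ge 0$; a node at level $i$ is thought of as the ball $B(x,\delta/\varepsilon^{i})$. Edges from a node at level $i$ may go to a child at any lower level $i'<i$ (an edge skipping levels, from $(x,i)$ to $(x,j)$ with $i>j+1$, is called a jump). The constants are fixed as $\phi=3/4$ (covering constant), $\gamma=1$ (containment constant), and $\varepsilon\le 1/8$. -}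

module Defs where

open import Level using (Level; _⊔_) renaming (suc to lsuc; zero to lzero)
open import Data.Nat using (ℕ; zero; suc; _<_)
open import Relation.Nullary using (¬_)
open import Relation.Binary.Core using (Rel)
open import Relation.Binary.Structures using (IsTotalOrder)
open import Relation.Binary.PropositionalEquality using (_≡_)
open import Algebra.Bundles using (CommutativeRing)

-- Ordered fields (stand-in for ℝ; the stdlib has no real numbers).
-- A field whose inverse is given as a total function, only required to
-- be a two-sided inverse on nonzero elements, with a compatible total order.

record OrderedField (c ℓ₁ ℓ₂ : Level) : Set (lsuc (c ⊔ ℓ₁ ⊔ ℓ₂)) where
  field
    commutativeRing : CommutativeRing c ℓ₁
  open CommutativeRing commutativeRing public
  infix 4 _≤_
  infix 8 _⁻¹
  field
    _≤_          : Rel Carrier ℓ₂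
    _⁻¹          : Carrier → Carrier
    0≉1          : ¬ (0# ≈ 1#)
    ⁻¹-inverse   : ∀ x → ¬ (x ≈ 0#) → x * (x ⁻¹) ≈ 1#
    isTotalOrder : IsTotalOrder _≈_ _≤_
    +-mono-≤     : ∀ {x y} z → x ≤ y → x + z ≤ y + z
    *-nonneg     : ∀ {x y} → 0# ≤ x → 0# ≤ y → 0# ≤ x * y

  _<ᶠ_ : Carrier → Carrier → Set (ℓ₁ ⊔ ℓ₂)
  x <ᶠ y = (x ≤ y) × ¬ (x ≈ y)
    where open import Data.Product using (_×_)

  fromℕ : ℕ → Carrier
  fromℕ zero    = 0#
  fromℕ (suc n) = 1# + fromℕ n

  _^_ : Carrier → ℕ → Carrier
  x ^ zero  = 1#
  x ^ suc n = x * (x ^ n)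

  _/_ : Carrier → Carrier → Carrier
  x / y = x * (y ⁻¹)

record MetricSpace {c ℓ₁ ℓ₂} (F : OrderedField c ℓ₁ ℓ₂) : Set (lsuc (c ⊔ ℓ₁ ⊔ ℓ₂)) where
  open OrderedField F
  field
    Point     : Set
    d         : Point → Point → Carrier
    nonneg    : ∀ x y → 0# ≤ d x y
    d-zero⇒≡  : ∀ x y → d x y ≈ 0# → x ≡ y
    d-refl    : ∀ x → d x x ≈ 0#
    d-sym     : ∀ x y → d x y ≈ d y x
    triangle  : ∀ x y z → d x z ≤ d x y + d y z

-- A node carries its point, its level and an (arbitrary) family of children.
-- (Since levels strictly decrease along edges, every such tree is
-- well-founded, so an inductive representation loses no generality.)

data Tree (X : Set) : Set₁ where
  node : (x : X) (i : ℕ) (Idx : Set) (child : Idx → Tree X) → Tree X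

module _ {X : Set} where

  point : Tree X → X
  point (node x _ _ _) = x

  level : Tree X → ℕ
  level (node _ i _ _) = i

  Children : Tree X → Set
  Children (node _ _ I _) = I

  childAt : (t : Tree X) → Children t → Tree X
  childAt (node _ _ _ ch) j = ch j

  infix 4 _≼_
  data _≼_ : Tree X → Tree X → Set₁ where
    here  : ∀ {T} → T ≼ T
    there : ∀ {S x i I ch} (j : I) → S ≼ ch j → S ≼ node x i I ch

  LevelsDecrease : Tree X → Set₁
  LevelsDecrease T = ∀ {S} → S ≼ T → ∀ j → level (childAt S j) < level S

module _ {c ℓ₁ ℓ₂} {F : OrderedField c ℓ₁ ℓ₂} (M : MetricSpace F) where
  open OrderedField F
  open MetricSpace M

  φ : Carrier
  φ = fromℕ 3 / fromℕ 4

  γ : Carrier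
  γ = 1#

  Covering : (δ ε : Carrier) → Tree Point → Set (lsuc lzero ⊔ ℓ₂)
  Covering δ ε T = ∀ {S} → S ≼ T → ∀ j →
    level (childAt S j) < level S →
    d (point (childAt S j)) (point S) ≤ φ * (δ / (ε ^ level S))

{-# OPTIONS --safe #-}

-- Write rᵢ = δ / εⁱ. A child (z, i′) of (x, i) lies within φ rᵢ of x, and since i′ < i
-- we have rᵢ′ ≤ rᵢ₋₁ = ε rᵢ, so φ rᵢ + γ rᵢ′ ≤ (φ + γ ε) rᵢ ≤ γ rᵢ as 3/4 + 1/8 ≤ 1.
-- Thus the ball of radius γ rᵢ′ about z lies in the ball of radius γ rᵢ about x, and
-- d(x, y) ≤ γ rᵢ − γ rₖ follows by the triangle inequality and induction along the path.

module Submission where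

open import Defs
open import Data.Nat using (_<_)

open import Data.Nat using (ℕ; zero; suc; _≤′_; ≤′-refl; ≤′-step; z≤n; s≤s)
  renaming (_≤_ to _≤ℕ_)
open import Data.Nat.Properties using (≤⇒≤′; n≤1+n)
open import Data.Product using (proj₁; proj₂)
open import Data.Sum using (inj₁; inj₂)
open import Relation.Nullary using (¬_; contradiction)
open import Relation.Binary.Bundles using (Poset)
open import Relation.Binary.Structures using (IsTotalOrder)
import Algebra.Properties.Ring as RingProperties
import Algebra.Solver.Ring.NaturalCoefficients.Default as NaturalSolver
import Relation.Binary.Reasoning.PartialOrder as PartialOrderReasoning

module OrderedFieldProperties {c ℓ₁ ℓ₂} (F : OrderedField c ℓ₁ ℓ₂) where
  open OrderedField F
  open RingProperties ring using (-1*x≈-x; -‿involutive; -‿distribʳ-*)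
  open NaturalSolver commutativeSemiring using (Polynomial; solve; _:=_; _:+_; _:*_; con)
  open IsTotalOrder isTotalOrder public
    using (total; antisym)
    renaming (refl to ≤-refl; trans to ≤-trans; reflexive to ≤-reflexive)

  poset : Poset c ℓ₁ ℓ₂
  poset = record { isPartialOrder = IsTotalOrder.isPartialOrder isTotalOrder }

  module ≤-Reasoning = PartialOrderReasoning poset
  open ≤-Reasoning

  x+[y-x]≈y : ∀ x y → x + (y - x) ≈ y
  x+[y-x]≈y x y = begin-equality
    x + (y - x)    ≈⟨ +-congˡ (+-comm y (- x)) ⟩
    x + (- x + y)  ≈⟨ +-assoc x (- x) y ⟨
    (x - x) + y    ≈⟨ +-congʳ (-‿inverseʳ x) ⟩
    0# + y         ≈⟨ +-identityˡ y ⟩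
    y              ∎

  +-monoʳ-≤ : ∀ z {x y} → x ≤ y → z + x ≤ z + y
  +-monoʳ-≤ z {x} {y} x≤y = begin
    z + x  ≈⟨ +-comm z x ⟩
    x + z  ≤⟨ +-mono-≤ z x≤y ⟩
    y + z  ≈⟨ +-comm y z ⟩
    z + y  ∎

  x≤x+y : ∀ x {y} → 0# ≤ y → x ≤ x + y
  x≤x+y x {y} 0≤y = begin
    x       ≈⟨ +-identityʳ x ⟨
    x + 0#  ≤⟨ +-monoʳ-≤ x 0≤y ⟩
    x + y   ∎

  x≤y⇒0≤y-x : ∀ {x y} → x ≤ y → 0# ≤ y - x
  x≤y⇒0≤y-x {x} {y} x≤y = begin
    0#     ≈⟨ -‿inverseʳ x ⟨
    x - x  ≤⟨ +-mono-≤ (- x) x≤y ⟩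
    y - x  ∎

  x≤0⇒0≤-x : ∀ {x} → x ≤ 0# → 0# ≤ - x
  x≤0⇒0≤-x {x} x≤0 = ≤-trans (x≤y⇒0≤y-x x≤0) (≤-reflexive (+-identityˡ (- x)))

  *-monoˡ-≤-nonNeg : ∀ {z x y} → 0# ≤ z → x ≤ y → x * z ≤ y * z
  *-monoˡ-≤-nonNeg {z} {x} {y} 0≤z x≤y = begin
    x * z                ≤⟨ x≤x+y (x * z) (*-nonneg (x≤y⇒0≤y-x x≤y) 0≤z) ⟩
    x * z + (y - x) * z  ≈⟨ distribʳ z x (y - x) ⟨
    (x + (y - x)) * z    ≈⟨ *-congʳ (x+[y-x]≈y x y) ⟩
    y * z                ∎

  *-monoʳ-≤-nonNeg : ∀ {z x y} → 0# ≤ z → x ≤ y → z * x ≤ z * y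
  *-monoʳ-≤-nonNeg {z} {x} {y} 0≤z x≤y = begin
    z * x  ≈⟨ *-comm z x ⟩
    x * z  ≤⟨ *-monoˡ-≤-nonNeg 0≤z x≤y ⟩
    y * z  ≈⟨ *-comm y z ⟩
    z * y  ∎

  0≤1 : 0# ≤ 1#
  0≤1 with total 0# 1#
  ... | inj₁ 0≤1 = 0≤1
  ... | inj₂ 1≤0 = begin
    0#               ≤⟨ *-nonneg 0≤-1 0≤-1 ⟩
    - 1# * - 1#      ≈⟨ -1*x≈-x (- 1#) ⟩
    - - 1#           ≈⟨ -‿involutive 1# ⟩
    1#               ∎
    where
    0≤-1 : 0# ≤ - 1#
    0≤-1 = x≤0⇒0≤-x 1≤0

  0≰-1 : ¬ (0# ≤ - 1#)
  0≰-1 0≤-1 = 0≉1 (antisym 0≤1 1≤0)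
    where
    1≤0 : 1# ≤ 0#
    1≤0 = begin
      1#         ≈⟨ +-identityˡ 1# ⟨
      0# + 1#    ≤⟨ +-mono-≤ 1# 0≤-1 ⟩
      - 1# + 1#  ≈⟨ -‿inverseˡ 1# ⟩
      0#         ∎

  ⁻¹-inverseˡ : ∀ {x} → x ≉ 0# → x ⁻¹ * x ≈ 1#
  ⁻¹-inverseˡ {x} x≉0 = trans (*-comm (x ⁻¹) x) (⁻¹-inverse x x≉0)

  *-≉0 : ∀ {x y} → x ≉ 0# → y ≉ 0# → x * y ≉ 0#
  *-≉0 {x} {y} x≉0 y≉0 xy≈0 = y≉0 (begin-equality
    y               ≈⟨ *-identityˡ y ⟨
    1# * y          ≈⟨ *-congʳ (⁻¹-inverseˡ x≉0) ⟨
    (x ⁻¹ * x) * y  ≈⟨ *-assoc (x ⁻¹) x y ⟩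
    x ⁻¹ * (x * y)  ≈⟨ *-congˡ xy≈0 ⟩
    x ⁻¹ * 0#       ≈⟨ zeroʳ (x ⁻¹) ⟩
    0#              ∎)

  ⁻¹-unique : ∀ {x y} → x * y ≈ 1# → x ⁻¹ ≈ y
  ⁻¹-unique {x} {y} xy≈1 = begin-equality
    x ⁻¹            ≈⟨ *-identityʳ (x ⁻¹) ⟨
    x ⁻¹ * 1#       ≈⟨ *-congˡ xy≈1 ⟨
    x ⁻¹ * (x * y)  ≈⟨ *-assoc (x ⁻¹) x y ⟨
    (x ⁻¹ * x) * y  ≈⟨ *-congʳ (⁻¹-inverseˡ x≉0) ⟩
    1# * y          ≈⟨ *-identityˡ y ⟩
    y               ∎
    where
    x≉0 : x ≉ 0#
    x≉0 x≈0 = 0≉1 (trans (sym (trans (*-congʳ x≈0) (zeroˡ y))) xy≈1)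

  x*[x*y]⁻¹≈y⁻¹ : ∀ {x y} → x * y ≉ 0# → x * (x * y) ⁻¹ ≈ y ⁻¹
  x*[x*y]⁻¹≈y⁻¹ {x} {y} xy≉0 = sym (⁻¹-unique (begin-equality
    y * (x * u)  ≈⟨ solve 3 (λ x y u → y :* (x :* u) := (x :* y) :* u) refl x y u ⟩
    (x * y) * u  ≈⟨ ⁻¹-inverse (x * y) xy≉0 ⟩
    1#           ∎))
    where u = (x * y) ⁻¹

  ⁻¹-nonNeg : ∀ {x} → 0# ≤ x → x ≉ 0# → 0# ≤ x ⁻¹
  ⁻¹-nonNeg {x} 0≤x x≉0 with total 0# (x ⁻¹)
  ... | inj₁ 0≤x⁻¹ = 0≤x⁻¹
  ... | inj₂ x⁻¹≤0 = contradiction 0≤-1 0≰-1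
    where
    0≤-1 : 0# ≤ - 1#
    0≤-1 = begin
      0#            ≤⟨ *-nonneg 0≤x (x≤0⇒0≤-x x⁻¹≤0) ⟩
      x * - (x ⁻¹)  ≈⟨ -‿distribʳ-* x (x ⁻¹) ⟨
      - (x * x ⁻¹)  ≈⟨ -‿cong (⁻¹-inverse x x≉0) ⟩
      - 1#          ∎

  ^-nonNeg : ∀ {x} → 0# ≤ x → ∀ n → 0# ≤ x ^ n
  ^-nonNeg 0≤x zero    = 0≤1
  ^-nonNeg 0≤x (suc n) = *-nonneg 0≤x (^-nonNeg 0≤x n)

  ^-≉0 : ∀ {x} → x ≉ 0# → ∀ n → x ^ n ≉ 0#
  ^-≉0 x≉0 zero    1≈0 = 0≉1 (sym 1≈0)
  ^-≉0 x≉0 (suc n)     = *-≉0 x≉0 (^-≉0 x≉0 n)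

  fromℕ-nonNeg : ∀ n → 0# ≤ fromℕ n
  fromℕ-nonNeg zero    = ≤-refl
  fromℕ-nonNeg (suc n) = ≤-trans 0≤1 (x≤x+y 1# (fromℕ-nonNeg n))

  fromℕ-mono-≤ : ∀ {m n} → m ≤ℕ n → fromℕ m ≤ fromℕ n
  fromℕ-mono-≤ {n = n} z≤n = fromℕ-nonNeg n
  fromℕ-mono-≤ (s≤s m≤n)   = +-monoʳ-≤ 1# (fromℕ-mono-≤ m≤n)

  fromℕ-suc≉0 : ∀ n → fromℕ (suc n) ≉ 0#
  fromℕ-suc≉0 n 1+n≈0 = 0≉1 (antisym 0≤1 (begin
    1#              ≤⟨ x≤x+y 1# (fromℕ-nonNeg n) ⟩
    1# + fromℕ n    ≈⟨ 1+n≈0 ⟩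
    0#              ∎))

  -- The solver reads a constant `con n` as `n × 1#`, which is not definitionally
  -- `fromℕ n`; this numeral is.
  :fromℕ : ∀ {k} → ℕ → Polynomial k
  :fromℕ zero    = con 0
  :fromℕ (suc n) = con 1 :+ :fromℕ n

  8*8⁻¹≈1 : fromℕ 8 * fromℕ 8 ⁻¹ ≈ 1#
  8*8⁻¹≈1 = ⁻¹-inverse (fromℕ 8) (fromℕ-suc≉0 7)

  4⁻¹≈2*8⁻¹ : fromℕ 4 ⁻¹ ≈ fromℕ 2 * fromℕ 8 ⁻¹
  4⁻¹≈2*8⁻¹ = ⁻¹-unique (begin-equality
    fromℕ 4 * (fromℕ 2 * e)  ≈⟨ solve 1 (λ e → :fromℕ 4 :* (:fromℕ 2 :* e) := :fromℕ 8 :* e) refl e ⟩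
    fromℕ 8 * e              ≈⟨ 8*8⁻¹≈1 ⟩
    1#                       ∎)
    where e = fromℕ 8 ⁻¹

  eighths≤1 : ∀ {m} → m ≤ℕ 8 → fromℕ m * fromℕ 8 ⁻¹ ≤ 1#
  eighths≤1 {m} m≤8 = begin
    fromℕ m * fromℕ 8 ⁻¹  ≤⟨ *-monoˡ-≤-nonNeg 0≤8⁻¹ (fromℕ-mono-≤ m≤8) ⟩
    fromℕ 8 * fromℕ 8 ⁻¹  ≈⟨ 8*8⁻¹≈1 ⟩
    1#                    ∎
    where
    0≤8⁻¹ : 0# ≤ fromℕ 8 ⁻¹
    0≤8⁻¹ = ⁻¹-nonNeg (fromℕ-nonNeg 8) (fromℕ-suc≉0 7)

  1/8≤1 : 1# / fromℕ 8 ≤ 1#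
  1/8≤1 = begin
    1# * fromℕ 8 ⁻¹       ≈⟨ *-congʳ (+-identityʳ 1#) ⟨
    fromℕ 1 * fromℕ 8 ⁻¹  ≤⟨ eighths≤1 (s≤s z≤n) ⟩
    1#                    ∎

  3/4+1/8≤1 : fromℕ 3 / fromℕ 4 + 1# / fromℕ 8 ≤ 1#
  3/4+1/8≤1 = begin
    fromℕ 3 * fromℕ 4 ⁻¹ + 1# * e    ≈⟨ +-congʳ (*-congˡ 4⁻¹≈2*8⁻¹) ⟩
    fromℕ 3 * (fromℕ 2 * e) + 1# * e  ≈⟨ solve 1 (λ e → :fromℕ 3 :* (:fromℕ 2 :* e) :+ con 1 :* e
                                                      := :fromℕ 7 :* e) refl e ⟩
    fromℕ 7 * e                       ≤⟨ eighths≤1 (n≤1+n 7) ⟩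
    1#                                ∎
    where e = fromℕ 8 ⁻¹

module GeometricRadii {c ℓ₁ ℓ₂} (F : OrderedField c ℓ₁ ℓ₂) (δ ε : OrderedField.Carrier F) where
  open OrderedField F
  open OrderedFieldProperties F
  open ≤-Reasoning
  open NaturalSolver commutativeSemiring using (solve; _:=_; _:+_; _:*_)

  radius : ℕ → Carrier
  radius n = δ / (ε ^ n)

  module _ (0≤δ : 0# ≤ δ) (0<ε : 0# <ᶠ ε) where

    ε≉0 : ε ≉ 0#
    ε≉0 ε≈0 = proj₂ 0<ε (sym ε≈0)

    radius-nonNeg : ∀ n → 0# ≤ radius n
    radius-nonNeg n = *-nonneg 0≤δ (⁻¹-nonNeg (^-nonNeg (proj₁ 0<ε) n) (^-≉0 ε≉0 n))

    ε*radius-suc≈radius : ∀ n → ε * radius (suc n) ≈ radius n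
    ε*radius-suc≈radius n = begin-equality
      ε * (δ * u)     ≈⟨ solve 3 (λ ε δ u → ε :* (δ :* u) := δ :* (ε :* u)) refl ε δ u ⟩
      δ * (ε * u)     ≈⟨ *-congˡ (x*[x*y]⁻¹≈y⁻¹ (^-≉0 ε≉0 (suc n))) ⟩
      δ * (ε ^ n) ⁻¹  ∎
      where u = (ε * ε ^ n) ⁻¹

    module _ (ε≤1 : ε ≤ 1#) where

      radius-mono-≤ : ∀ {m n} → m ≤ℕ n → radius m ≤ radius n
      radius-mono-≤ m≤n = go (≤⇒≤′ m≤n)
        where
        go : ∀ {m n} → m ≤′ n → radius m ≤ radius n
        go ≤′-refl = ≤-refl
        go {m} {suc n} (≤′-step m≤′n) = begin
          radius m               ≤⟨ go m≤′n ⟩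
          radius n               ≈⟨ ε*radius-suc≈radius n ⟨
          ε * radius (suc n)     ≤⟨ *-monoˡ-≤-nonNeg (radius-nonNeg (suc n)) ε≤1 ⟩
          1# * radius (suc n)    ≈⟨ *-identityˡ (radius (suc n)) ⟩
          radius (suc n)         ∎

      radius-<⇒≤ε*radius : ∀ {m n} → m < n → radius m ≤ ε * radius n
      radius-<⇒≤ε*radius {m} {suc n} (s≤s m≤n) = begin
        radius m            ≤⟨ radius-mono-≤ m≤n ⟩
        radius n            ≈⟨ ε*radius-suc≈radius n ⟨
        ε * radius (suc n)  ∎

      scaled-radius-slack : ∀ φ γ → 0# ≤ γ → φ + γ * ε ≤ γ →
                            ∀ {i j} → j < i → φ * radius i + γ * radius j ≤ γ * radius i
      scaled-radius-slack φ γ 0≤γ φ+γε≤γ {i} {j} j<i = begin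
        φ * r + γ * radius j  ≤⟨ +-monoʳ-≤ (φ * r) (*-monoʳ-≤-nonNeg 0≤γ (radius-<⇒≤ε*radius j<i)) ⟩
        φ * r + γ * (ε * r)   ≈⟨ solve 4 (λ φ γ ε r → φ :* r :+ γ :* (ε :* r) := (φ :+ γ :* ε) :* r)
                                       refl φ γ ε r ⟩
        (φ + γ * ε) * r       ≤⟨ *-monoˡ-≤-nonNeg (radius-nonNeg i) φ+γε≤γ ⟩
        γ * r                 ∎
        where r = radius i

≼-trans : ∀ {X : Set} {A B C : Tree X} → A ≼ B → B ≼ C → A ≼ C
≼-trans A≼B here          = A≼B
≼-trans A≼B (there j B≼C) = there j (≼-trans A≼B B≼C)

module _ {c ℓ₁ ℓ₂} {F : OrderedField c ℓ₁ ℓ₂} (M : MetricSpace F) where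
  open OrderedField F
  open MetricSpace M
  open OrderedFieldProperties F
  open ≤-Reasoning

  module _ (edge radius : ℕ → Carrier)
    (slack : ∀ {i j} → j < i → edge i + radius j ≤ radius i)
    (T : Tree Point) (decrease : LevelsDecrease T)
    (cover : ∀ {S} → S ≼ T → ∀ j → level (childAt S j) < level S →
               d (point (childAt S j)) (point S) ≤ edge (level S))
    where

    descendant-distance≤radius-difference :
      ∀ {S} → S ≼ T → ∀ {S′} → S′ ≼ S →
      d (point S) (point S′) ≤ radius (level S) - radius (level S′)
    descendant-distance≤radius-difference {S} _ here = begin
      d (point S) (point S)                ≈⟨ d-refl (point S) ⟩
      0#                                   ≈⟨ -‿inverseʳ (radius (level S)) ⟨
      radius (level S) - radius (level S)  ∎
    descendant-distance≤radius-difference {node x i I child} S≼T {S′} (there j S′≼child) = begin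
      d x y                            ≤⟨ triangle x z y ⟩
      d x z + d z y                    ≈⟨ +-congʳ (d-sym x z) ⟩
      d z x + d z y                    ≤⟨ +-mono-≤ (d z y) (cover S≼T j i′<i) ⟩
      edge i + d z y                   ≤⟨ +-monoʳ-≤ (edge i) ih ⟩
      edge i + (radius i′ - radius k)  ≈⟨ +-assoc (edge i) (radius i′) (- radius k) ⟨
      (edge i + radius i′) - radius k  ≤⟨ +-mono-≤ (- radius k) (slack i′<i) ⟩
      radius i - radius k              ∎
      where
      y = point S′
      z = point (child j)
      i′ = level (child j)
      k = level S′
      i′<i : i′ < i
      i′<i = decrease S≼T j
      ih : d z y ≤ radius i′ - radius k
      ih = descendant-distance≤radius-difference (≼-trans (there j here) S≼T) S′≼child

mainTheorem1 : ∀ {c ℓ₁ ℓ₂} {F : OrderedField c ℓ₁ ℓ₂} (M : MetricSpace F) →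
  let open OrderedField F
      open MetricSpace M
  in (δ ε : Carrier) →
     0# <ᶠ δ → 0# <ᶠ ε → ε ≤ 1# / fromℕ 8 →
     (T : Tree Point) → LevelsDecrease T → Covering M δ ε T →
     ∀ {S} → S ≼ T → ∀ {S′} → S′ ≼ S → level S′ < level S →
     d (point S) (point S′) ≤
       (γ M * (δ / (ε ^ level S))) - (γ M * (δ / (ε ^ level S′)))
-- The levels need not differ: for S′ = S both sides vanish.
mainTheorem1 {F = F} M δ ε 0<δ 0<ε ε≤1/8 T decrease cover S≼T S′≼S _ =
  descendant-distance≤radius-difference M (λ i → φ M * radius i) (λ i → γ M * radius i)
    (scaled-radius-slack (proj₁ 0<δ) 0<ε ε≤1 (φ M) (γ M) 0≤1 φ+γε≤γ)
    T decrease cover S≼T S′≼S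
  where
  open OrderedField F
  open OrderedFieldProperties F
  open GeometricRadii F δ ε
  open ≤-Reasoning

  ε≤1 : ε ≤ 1#
  ε≤1 = ≤-trans ε≤1/8 1/8≤1

  φ+γε≤γ : φ M + γ M * ε ≤ γ M
  φ+γε≤γ = begin
    fromℕ 3 / fromℕ 4 + 1# * ε       ≈⟨ +-congˡ (*-identityˡ ε) ⟩
    fromℕ 3 / fromℕ 4 + ε            ≤⟨ +-monoʳ-≤ (fromℕ 3 / fromℕ 4) ε≤1/8 ⟩
    fromℕ 3 / fromℕ 4 + 1# / fromℕ 8  ≤⟨ 3/4+1/8≤1 ⟩
    1#                                ∎
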